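{- Let $M=(V,D)$ be a proper set system. Then $M$ is strongly divisible if and only if for every sequence $\varphi$ of vertex flips, the set system $M\varphi$ contains at least two sets.
   Context: A set system is a pair $M=(V,D)$ with $V$ finite and $D$ a family of subsets of $V$; it is proper if $D\neq\emptyset$; write $Z\in M$ for $Z\in D$. $\oplus$ is symmetric difference. Pivot: $M*X=(V,\{Z\oplus X:Z\in D\})$ for $X\subseteq V$; loop complementation: $M+w=(V,D\oplus\{Z\cup\{w\}:Z\in D,w\notin Z\})$ for $w\in V$; operations are applied left to right and dual pivot is $M\,\bar{*}\,w=M+w*w+w$. A vertex flip is any element of the group of operations generated by $*w$ and $+w$ for some single $w\in V$. $M$ is divisible by $u$ if there are $X_1,X_2\in M$ with $u\in X_1\oplus X_2$. $M$ is strongly divisible by $u$ if it is divisible by $u$ and there is $X\in M$ with $X\oplus\{u\}\notin M$; $M$ is strongly divisible if it is strongly divisible by some $u\in V$. -}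

module Defs where

open import Data.Nat using (ℕ)
open import Data.Bool using (Bool; true; false; _xor_; _∧_; if_then_else_)
open import Data.Fin using (Fin)
open import Data.Fin.Subset using (Subset; _∈_; _∉_; ⁅_⁆; _-_)
open import Data.Vec using (zipWith; lookup)
open import Data.List using (List; []; _∷_)
open import Data.Product using (Σ; ∃; ∃-syntax; _×_; _,_)
open import Relation.Nullary using (¬_)
open import Relation.Binary.PropositionalEquality using (_≡_; _≢_)

-- Ground set V = Fin n; a subset of V is a 'Subset n'.
-- A set system M = (V, D) is given by the characteristic function of D.
SetSystem : ℕ → Set
SetSystem n = Subset n → Bool

variable n : ℕ

_∈ₛ_ : Subset n → SetSystem n → Set
Z ∈ₛ M = M Z ≡ true

_∉ₛ_ : Subset n → SetSystem n → Set
Z ∉ₛ M = ¬ (Z ∈ₛ M)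

_⊕_ : Subset n → Subset n → Subset n
_⊕_ = zipWith _xor_

Proper : SetSystem n → Set
Proper M = ∃[ Z ] Z ∈ₛ M

-- Pivot M * X : D' = { Z ⊕ X : Z ∈ D },  i.e.  Y ∈ D'  iff  Y ⊕ X ∈ D
_*_ : SetSystem n → Subset n → SetSystem n
(M * X) Y = M (Y ⊕ X)

-- Loop complementation M + w : D' = D ⊕ { Z ∪ {w} : Z ∈ D, w ∉ Z },
-- i.e. Y ∈ D'  iff  (Y ∈ D) xor (w ∈ Y and Y - {w} ∈ D)
_+_ : SetSystem n → Fin n → SetSystem n
(M + w) Y = M Y xor (lookup Y w ∧ M (Y - w))

-- Generators of the group of vertex flips at a single vertex w
data FlipGen : Set where
  piv  : FlipGen
  loop : FlipGen

applyGen : SetSystem n → Fin n → FlipGen → SetSystem n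
applyGen M w piv  = M * ⁅ w ⁆
applyGen M w loop = M + w

-- A vertex flip: a vertex w together with a word in *w, +w
-- (both generators are involutions, so every element of the generated
-- group is represented by such a word), applied left to right.
VertexFlip : ℕ → Set
VertexFlip n = Σ (Fin n) (λ _ → List FlipGen)

applyWord : SetSystem n → Fin n → List FlipGen → SetSystem n
applyWord M w []       = M
applyWord M w (g ∷ gs) = applyWord (applyGen M w g) w gs

applyFlip : SetSystem n → VertexFlip n → SetSystem n
applyFlip M (w , gs) = applyWord M w gs

-- M φ for a sequence φ of vertex flips, applied left to right
applySeq : SetSystem n → List (VertexFlip n) → SetSystem n
applySeq M []       = M
applySeq M (f ∷ fs) = applySeq (applyFlip M f) fs

Divisible : SetSystem n → Fin n → Set
Divisible M u = ∃[ X₁ ] ∃[ X₂ ] (X₁ ∈ₛ M × X₂ ∈ₛ M × u ∈ (X₁ ⊕ X₂))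

StronglyDivisibleBy : SetSystem n → Fin n → Set
StronglyDivisibleBy M u = Divisible M u × (∃[ X ] (X ∈ₛ M × (X ⊕ ⁅ u ⁆) ∉ₛ M))

StronglyDivisible : SetSystem n → Set
StronglyDivisible M = ∃[ u ] StronglyDivisibleBy M u

AtLeastTwo : SetSystem n → Set
AtLeastTwo M = ∃[ Y ] ∃[ Z ] (Y ≢ Z × Y ∈ₛ M × Z ∈ₛ M)

-- M is not strongly divisible exactly when at every vertex v it has one of
-- two shapes: all members agree on v, or M is closed under toggling v.  A
-- pivot or loop complementation at w leaves the shape at every other vertex
-- unchanged and changes the shape at w in a controlled way (a pivot negates
-- the common value, a loop complementation exchanges "no member contains w"
-- with "closed under toggling w").  So not being strongly divisible is
-- preserved by flips, and as both generators are involutions, so is being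
-- strongly divisible; a strongly divisible system has two members differing
-- at u.  Conversely, if M is not strongly divisible, flipping every vertex in
-- turn into the shape "no member contains v" leaves a system whose only
-- possible member is the empty set.

module Submission where

open import Defs
open import Data.Nat using (ℕ)
open import Data.Bool using (Bool; true; false; not; _xor_)
open import Data.Bool.Properties
  using ( xor-assoc; xor-comm; xor-same; xor-identityʳ; xor-inverseˡ; xor-inverseʳ
        ; not-involutive; ¬-not; not-¬)
  renaming (_≟_ to _≟ᵇ_)
open import Data.Empty using (⊥-elim)
open import Function using (_∘_)
open import Data.Fin using (Fin; _≟_)
open import Data.Fin.Properties using (any?)
open import Data.Fin.Subset using (Subset; ⊥; ⁅_⁆; _-_; _∈_; inside; outside)
open import Data.Fin.Subset.Properties using (x∈⁅x⁆; x≢y⇒x∉⁅y⁆; p─⊥≡p; anySubset?; _∈?_)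
open import Data.List using (List; []; _∷_; _++_; _∷ʳ_; allFin)
open import Data.List.Membership.Propositional using () renaming (_∈_ to _∈ˡ_)
open import Data.List.Membership.Propositional.Properties using (∈-allFin)
open import Data.List.Relation.Unary.Any using (here; there)
open import Data.Sum using (_⊎_; inj₁; inj₂)
open import Data.Product using (_×_; _,_; ∃-syntax; proj₂)
open import Data.Vec using ([]; _∷_; lookup; here; there)
open import Data.Vec.Properties
  using (lookup-zipWith; lookup-replicate; []=⇒lookup; lookup⇒[]=;
         zipWith-comm; zipWith-assoc; zipWith-identityʳ)
open import Data.Vec.Relation.Binary.Pointwise.Extensional using (ext; Pointwise-≡⇒≡)
open import Relation.Nullary using (¬_; Dec; yes; no; contradiction)
open import Relation.Nullary.Decidable using (_×-dec_; ¬?)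
open import Relation.Binary.PropositionalEquality
  using (_≡_; _≢_; refl; sym; trans; cong; cong₂; subst; ≢-sym; module ≡-Reasoning)

open ≡-Reasoning

private
  variable
    M : SetSystem n
    v w : Fin n

⊕-comm : (X Y : Subset n) → X ⊕ Y ≡ Y ⊕ X
⊕-comm = zipWith-comm xor-comm

⊕-assoc : (X Y Z : Subset n) → (X ⊕ Y) ⊕ Z ≡ X ⊕ (Y ⊕ Z)
⊕-assoc = zipWith-assoc xor-assoc

⊕-identityʳ : (X : Subset n) → X ⊕ ⊥ ≡ X
⊕-identityʳ = zipWith-identityʳ xor-identityʳ

⊕-self : (X : Subset n) → X ⊕ X ≡ ⊥
⊕-self []      = refl
⊕-self (x ∷ X) = cong₂ _∷_ (xor-same x) (⊕-self X)

⊕-cancelʳ : (X Y : Subset n) → (X ⊕ Y) ⊕ Y ≡ X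
⊕-cancelʳ X Y = begin
  (X ⊕ Y) ⊕ Y  ≡⟨ ⊕-assoc X Y Y ⟩
  X ⊕ (Y ⊕ Y)  ≡⟨ cong (X ⊕_) (⊕-self Y) ⟩
  X ⊕ ⊥        ≡⟨ ⊕-identityʳ X ⟩
  X            ∎

X⊕Y⊕Z≡X⊕Z⊕Y : (X Y Z : Subset n) → (X ⊕ Y) ⊕ Z ≡ (X ⊕ Z) ⊕ Y
X⊕Y⊕Z≡X⊕Z⊕Y X Y Z = begin
  (X ⊕ Y) ⊕ Z  ≡⟨ ⊕-assoc X Y Z ⟩
  X ⊕ (Y ⊕ Z)  ≡⟨ cong (X ⊕_) (⊕-comm Y Z) ⟩
  X ⊕ (Z ⊕ Y)  ≡⟨ ⊕-assoc X Z Y ⟨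
  (X ⊕ Z) ⊕ Y  ∎

lookup-⊕ : (X Y : Subset n) (i : Fin n) → lookup (X ⊕ Y) i ≡ lookup X i xor lookup Y i
lookup-⊕ X Y i = lookup-zipWith _xor_ i X Y

lookup-⊕⁅x⁆-self : (X : Subset n) (x : Fin n) → lookup (X ⊕ ⁅ x ⁆) x ≡ not (lookup X x)
lookup-⊕⁅x⁆-self X x = begin
  lookup (X ⊕ ⁅ x ⁆) x           ≡⟨ lookup-⊕ X ⁅ x ⁆ x ⟩
  lookup X x xor lookup ⁅ x ⁆ x  ≡⟨ cong (lookup X x xor_) ([]=⇒lookup (x∈⁅x⁆ x)) ⟩
  lookup X x xor true            ≡⟨ xor-comm (lookup X x) true ⟩
  not (lookup X x)               ∎

lookup-⊕⁅x⁆-not : (X : Subset n) {x : Fin n} {b : Bool} →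
                  lookup X x ≡ b → lookup (X ⊕ ⁅ x ⁆) x ≡ not b
lookup-⊕⁅x⁆-not X {x} Xx≡b = trans (lookup-⊕⁅x⁆-self X x) (cong not Xx≡b)

lookup-⊕⁅x⁆-other : (X : Subset n) {x y : Fin n} →
                    x ≢ y → lookup (X ⊕ ⁅ x ⁆) y ≡ lookup X y
lookup-⊕⁅x⁆-other X {x} {y} x≢y = begin
  lookup (X ⊕ ⁅ x ⁆) y           ≡⟨ lookup-⊕ X ⁅ x ⁆ y ⟩
  lookup X y xor lookup ⁅ x ⁆ y  ≡⟨ cong (lookup X y xor_) y∉⁅x⁆ ⟩
  lookup X y xor false           ≡⟨ xor-identityʳ (lookup X y) ⟩
  lookup X y                     ∎
  where
  y∉⁅x⁆ : lookup ⁅ x ⁆ y ≡ false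
  y∉⁅x⁆ = ¬-not (x≢y⇒x∉⁅y⁆ (≢-sym x≢y) ∘ lookup⇒[]= y ⁅ x ⁆)

x∈p⇒p-x≡p⊕⁅x⁆ : {p : Subset n} {x : Fin n} → x ∈ p → p - x ≡ p ⊕ ⁅ x ⁆
x∈p⇒p-x≡p⊕⁅x⁆ {p = inside ∷ p} here =
  cong (outside ∷_) (trans (p─⊥≡p p) (sym (⊕-identityʳ p)))
x∈p⇒p-x≡p⊕⁅x⁆ {p = b ∷ p} (there x∈p) =
  cong₂ _∷_ (sym (xor-identityʳ b)) (x∈p⇒p-x≡p⊕⁅x⁆ x∈p)

lookup-⊕-differ : {X Y : Subset n} {u : Fin n} → u ∈ X ⊕ Y → lookup X u ≢ lookup Y u
lookup-⊕-differ {X = X} {Y} {u} u∈X⊕Y Xu≡Yu = contradiction (begin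
  true                       ≡⟨ []=⇒lookup u∈X⊕Y ⟨
  lookup (X ⊕ Y) u           ≡⟨ lookup-⊕ X Y u ⟩
  lookup X u xor lookup Y u  ≡⟨ cong (_xor lookup Y u) Xu≡Yu ⟩
  lookup Y u xor lookup Y u  ≡⟨ xor-same (lookup Y u) ⟩
  false                    ∎) λ ()

lookup-differ-⊕ : (X Y : Subset n) {u : Fin n} → lookup X u ≢ lookup Y u → u ∈ X ⊕ Y
lookup-differ-⊕ X Y {u} Xu≢Yu = lookup⇒[]= u (X ⊕ Y) (begin
  lookup (X ⊕ Y) u                 ≡⟨ lookup-⊕ X Y u ⟩
  lookup X u xor lookup Y u        ≡⟨ cong (lookup X u xor_) (¬-not (≢-sym Xu≢Yu)) ⟩
  lookup X u xor not (lookup X u)  ≡⟨ xor-inverseʳ (lookup X u) ⟩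
  true                           ∎)

b≡true⊎b≡false : (b : Bool) → b ≡ true ⊎ b ≡ false
b≡true⊎b≡false true  = inj₁ refl
b≡true⊎b≡false false = inj₂ refl

+-outside : (M : SetSystem n) (Y : Subset n) → lookup Y w ≡ false → (M + w) Y ≡ M Y
+-outside M Y w∉Y rewrite w∉Y = xor-identityʳ (M Y)

+-inside : (M : SetSystem n) (Y : Subset n) → lookup Y w ≡ true →
           (M + w) Y ≡ M Y xor M (Y ⊕ ⁅ w ⁆)
+-inside {w = w} M Y w∈Y rewrite w∈Y | x∈p⇒p-x≡p⊕⁅x⁆ (lookup⇒[]= w Y w∈Y) = refl

xor-cancelʳ : (a b : Bool) → (a xor b) xor b ≡ a
xor-cancelʳ true  b = xor-inverseˡ b
xor-cancelʳ false b = xor-same b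

+-involutive : (M : SetSystem n) (w : Fin n) (Y : Subset n) → ((M + w) + w) Y ≡ M Y
+-involutive M w Y with b≡true⊎b≡false (lookup Y w)
... | inj₂ w∉Y = trans (+-outside (M + w) Y w∉Y) (+-outside M Y w∉Y)
... | inj₁ w∈Y = begin
  ((M + w) + w) Y                            ≡⟨ +-inside (M + w) Y w∈Y ⟩
  (M + w) Y xor (M + w) (Y ⊕ ⁅ w ⁆)          ≡⟨ cong₂ _xor_ (+-inside M Y w∈Y) (+-outside M _ w∉Y⊕w) ⟩
  (M Y xor M (Y ⊕ ⁅ w ⁆)) xor M (Y ⊕ ⁅ w ⁆)  ≡⟨ xor-cancelʳ (M Y) (M (Y ⊕ ⁅ w ⁆)) ⟩
  M Y                                        ∎
  where w∉Y⊕w = lookup-⊕⁅x⁆-not Y w∈Y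

applyGen-involutive : (M : SetSystem n) (w : Fin n) (g : FlipGen) (Y : Subset n) →
                      applyGen (applyGen M w g) w g Y ≡ M Y
applyGen-involutive M w piv  Y = cong M (⊕-cancelʳ Y ⁅ w ⁆)
applyGen-involutive M w loop Y = +-involutive M w Y

data Shape : Set where
  uniform   : Bool → Shape
  symmetric : Shape

ShapedAt : SetSystem n → Fin n → Shape → Set
ShapedAt M v (uniform b) = ∀ Y → Y ∈ₛ M → lookup Y v ≡ b
ShapedAt M v symmetric   = ∀ Y → M (Y ⊕ ⁅ v ⁆) ≡ M Y

Shaped : SetSystem n → Set
Shaped M = ∀ v → ∃[ s ] ShapedAt M v s

Avoids : SetSystem n → Fin n → Set
Avoids M v = ShapedAt M v (uniform false)

avoids⇒∉ₛ : Avoids M w → (Y : Subset n) → lookup Y w ≡ true → M Y ≡ false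
avoids⇒∉ₛ {M = M} avoids Y w∈Y with M Y in Y∈M
... | true  = contradiction (trans (sym (avoids Y Y∈M)) w∈Y) λ ()
... | false = refl

shapedAt⇒¬stronglyDivisibleBy : (s : Shape) → ShapedAt M v s → ¬ StronglyDivisibleBy M v
shapedAt⇒¬stronglyDivisibleBy (uniform b) agree ((X₁ , X₂ , X₁∈M , X₂∈M , v∈X₁⊕X₂) , _) =
  lookup-⊕-differ v∈X₁⊕X₂ (trans (agree X₁ X₁∈M) (sym (agree X₂ X₂∈M)))
shapedAt⇒¬stronglyDivisibleBy symmetric closed (_ , X , X∈M , X⊕v∉M) =
  X⊕v∉M (trans (closed X) X∈M)

¬stronglyDivisibleBy⇒shapedAt : (M : SetSystem n) (v : Fin n) →
                                ¬ StronglyDivisibleBy M v → ∃[ s ] ShapedAt M v s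
¬stronglyDivisibleBy⇒shapedAt M v ¬sd
  with anySubset? (λ X → (M X ≟ᵇ true) ×-dec ¬? (M (X ⊕ ⁅ v ⁆) ≟ᵇ true))
... | yes (X , X∈M , X⊕v∉M) = uniform (lookup X v) , agree
  where
  agree : ∀ Y → Y ∈ₛ M → lookup Y v ≡ lookup X v
  agree Y Y∈M with lookup Y v ≟ᵇ lookup X v
  ... | yes Yv≡Xv = Yv≡Xv
  ... | no  Yv≢Xv =
    ⊥-elim (¬sd ((X , Y , X∈M , Y∈M , lookup-differ-⊕ X Y (≢-sym Yv≢Xv)) , X , X∈M , X⊕v∉M))
... | no ∄X = symmetric , closed
  where
  closed : ∀ Y → M (Y ⊕ ⁅ v ⁆) ≡ M Y
  closed Y with M Y in Y∈?M | M (Y ⊕ ⁅ v ⁆) in Y⊕v∈?M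
  ... | true  | true  = refl
  ... | false | false = refl
  ... | true  | false = ⊥-elim (∄X (Y , Y∈?M , not-¬ Y⊕v∈?M))
  ... | false | true  =
    ⊥-elim (∄X (Y ⊕ ⁅ v ⁆ , Y⊕v∈?M , not-¬ (trans (cong M (⊕-cancelʳ Y ⁅ v ⁆)) Y∈?M)))

shaped⇒¬stronglyDivisible : Shaped M → ¬ StronglyDivisible M
shaped⇒¬stronglyDivisible shaped (u , sd) = shapedAt⇒¬stronglyDivisibleBy _ (proj₂ (shaped u)) sd

¬stronglyDivisible⇒shaped : ¬ StronglyDivisible M → Shaped M
¬stronglyDivisible⇒shaped {M = M} ¬sd v = ¬stronglyDivisibleBy⇒shapedAt M v (λ sd → ¬sd (v , sd))

stronglyDivisible? : (M : SetSystem n) → Dec (StronglyDivisible M)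
stronglyDivisible? M = any? λ u → divisible? u ×-dec
  anySubset? (λ X → (M X ≟ᵇ true) ×-dec ¬? (M (X ⊕ ⁅ u ⁆) ≟ᵇ true))
  where
  divisible? : (u : Fin _) → Dec (Divisible M u)
  divisible? u = anySubset? λ X₁ → anySubset? λ X₂ →
    (M X₁ ≟ᵇ true) ×-dec (M X₂ ≟ᵇ true) ×-dec (u ∈? X₁ ⊕ X₂)

shapeAfter : FlipGen → Shape → Shape
shapeAfter piv  (uniform b)     = uniform (not b)
shapeAfter piv  symmetric       = symmetric
shapeAfter loop (uniform false) = symmetric
shapeAfter loop (uniform true)  = uniform true
shapeAfter loop symmetric       = uniform false

*-shapedAt-self : (M : SetSystem n) (s : Shape) → ShapedAt M w s →
                  ShapedAt (M * ⁅ w ⁆) w (shapeAfter piv s)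
*-shapedAt-self {w = w} M (uniform b) agree Y Y⊕w∈M = begin
  lookup Y w                  ≡⟨ not-involutive (lookup Y w) ⟨
  not (not (lookup Y w))      ≡⟨ cong not (lookup-⊕⁅x⁆-self Y w) ⟨
  not (lookup (Y ⊕ ⁅ w ⁆) w)  ≡⟨ cong not (agree (Y ⊕ ⁅ w ⁆) Y⊕w∈M) ⟩
  not b                       ∎
*-shapedAt-self {w = w} M symmetric closed Y = closed (Y ⊕ ⁅ w ⁆)

+-shapedAt-self : (M : SetSystem n) (s : Shape) → ShapedAt M w s →
                  ShapedAt (M + w) w (shapeAfter loop s)
+-shapedAt-self {w = w} M (uniform false) avoids Y with b≡true⊎b≡false (lookup Y w)
... | inj₂ w∉Y = begin
  (M + w) (Y ⊕ ⁅ w ⁆)                        ≡⟨ +-inside M (Y ⊕ ⁅ w ⁆) w∈Y⊕w ⟩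
  M (Y ⊕ ⁅ w ⁆) xor M ((Y ⊕ ⁅ w ⁆) ⊕ ⁅ w ⁆)  ≡⟨ cong₂ _xor_ Y⊕w∉M (cong M (⊕-cancelʳ Y _)) ⟩
  M Y                                        ≡⟨ +-outside M Y w∉Y ⟨
  (M + w) Y                                  ∎
  where
  w∈Y⊕w = lookup-⊕⁅x⁆-not Y w∉Y
  Y⊕w∉M = avoids⇒∉ₛ avoids (Y ⊕ ⁅ w ⁆) w∈Y⊕w
... | inj₁ w∈Y = begin
  (M + w) (Y ⊕ ⁅ w ⁆)    ≡⟨ +-outside M (Y ⊕ ⁅ w ⁆) (lookup-⊕⁅x⁆-not Y w∈Y) ⟩
  M (Y ⊕ ⁅ w ⁆)          ≡⟨ cong (_xor M (Y ⊕ ⁅ w ⁆)) (avoids⇒∉ₛ avoids Y w∈Y) ⟨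
  M Y xor M (Y ⊕ ⁅ w ⁆)  ≡⟨ +-inside M Y w∈Y ⟨
  (M + w) Y              ∎
+-shapedAt-self {w = w} M (uniform true) agree Y Y∈M+w with b≡true⊎b≡false (lookup Y w)
... | inj₁ w∈Y = w∈Y
... | inj₂ w∉Y = agree Y (trans (sym (+-outside M Y w∉Y)) Y∈M+w)
+-shapedAt-self {w = w} M symmetric closed Y Y∈M+w with b≡true⊎b≡false (lookup Y w)
... | inj₂ w∉Y = w∉Y
... | inj₁ w∈Y = contradiction (begin
  true                   ≡⟨ Y∈M+w ⟨
  (M + w) Y              ≡⟨ +-inside M Y w∈Y ⟩
  M Y xor M (Y ⊕ ⁅ w ⁆)  ≡⟨ cong (M Y xor_) (closed Y) ⟩
  M Y xor M Y            ≡⟨ xor-same (M Y) ⟩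
  false                  ∎) λ ()

*-shapedAt-other : (M : SetSystem n) (s : Shape) → w ≢ v → ShapedAt M v s →
                   ShapedAt (M * ⁅ w ⁆) v s
*-shapedAt-other {w = w} M (uniform b) w≢v agree Y Y⊕w∈M =
  trans (sym (lookup-⊕⁅x⁆-other Y w≢v)) (agree (Y ⊕ ⁅ w ⁆) Y⊕w∈M)
*-shapedAt-other {w = w} {v} M symmetric w≢v closed Y =
  trans (cong M (X⊕Y⊕Z≡X⊕Z⊕Y Y ⁅ v ⁆ ⁅ w ⁆)) (closed (Y ⊕ ⁅ w ⁆))

+-shapedAt-other : (M : SetSystem n) (s : Shape) → w ≢ v → ShapedAt M v s →
                   ShapedAt (M + w) v s
+-shapedAt-other {w = w} M (uniform b) w≢v agree Y Y∈M+w with b≡true⊎b≡false (lookup Y w)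
... | inj₂ w∉Y = agree Y (trans (sym (+-outside M Y w∉Y)) Y∈M+w)
... | inj₁ w∈Y with b≡true⊎b≡false (M Y)
...   | inj₁ Y∈M = agree Y Y∈M
...   | inj₂ Y∉M = trans (sym (lookup-⊕⁅x⁆-other Y w≢v)) (agree (Y ⊕ ⁅ w ⁆) (begin
  M (Y ⊕ ⁅ w ⁆)          ≡⟨ cong (_xor M (Y ⊕ ⁅ w ⁆)) Y∉M ⟨
  M Y xor M (Y ⊕ ⁅ w ⁆)  ≡⟨ +-inside M Y w∈Y ⟨
  (M + w) Y              ≡⟨ Y∈M+w ⟩
  true                     ∎))
+-shapedAt-other {w = w} {v} M symmetric w≢v closed Y with b≡true⊎b≡false (lookup Y w)
... | inj₂ w∉Y = begin
  (M + w) (Y ⊕ ⁅ v ⁆)  ≡⟨ +-outside M (Y ⊕ ⁅ v ⁆) (trans w-unchanged w∉Y) ⟩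
  M (Y ⊕ ⁅ v ⁆)        ≡⟨ closed Y ⟩
  M Y                  ≡⟨ +-outside M Y w∉Y ⟨
  (M + w) Y            ∎
  where w-unchanged = lookup-⊕⁅x⁆-other Y (≢-sym w≢v)
... | inj₁ w∈Y = begin
  (M + w) (Y ⊕ ⁅ v ⁆)
    ≡⟨ +-inside M (Y ⊕ ⁅ v ⁆) (trans w-unchanged w∈Y) ⟩
  M (Y ⊕ ⁅ v ⁆) xor M ((Y ⊕ ⁅ v ⁆) ⊕ ⁅ w ⁆)
    ≡⟨ cong₂ _xor_ (closed Y) (cong M (X⊕Y⊕Z≡X⊕Z⊕Y Y ⁅ v ⁆ ⁅ w ⁆)) ⟩
  M Y xor M ((Y ⊕ ⁅ w ⁆) ⊕ ⁅ v ⁆)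
    ≡⟨ cong (M Y xor_) (closed (Y ⊕ ⁅ w ⁆)) ⟩
  M Y xor M (Y ⊕ ⁅ w ⁆)
    ≡⟨ +-inside M Y w∈Y ⟨
  (M + w) Y
    ∎
  where w-unchanged = lookup-⊕⁅x⁆-other Y (≢-sym w≢v)

applyGen-shapedAt-self : (M : SetSystem n) (g : FlipGen) (s : Shape) → ShapedAt M w s →
                         ShapedAt (applyGen M w g) w (shapeAfter g s)
applyGen-shapedAt-self M piv  = *-shapedAt-self M
applyGen-shapedAt-self M loop = +-shapedAt-self M

applyGen-shapedAt-other : (M : SetSystem n) (g : FlipGen) (s : Shape) → w ≢ v → ShapedAt M v s →
                          ShapedAt (applyGen M w g) v s
applyGen-shapedAt-other M piv  = *-shapedAt-other M
applyGen-shapedAt-other M loop = +-shapedAt-other M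

applyWord-shapedAt-other : (M : SetSystem n) (gs : List FlipGen) (s : Shape) → w ≢ v →
                           ShapedAt M v s → ShapedAt (applyWord M w gs) v s
applyWord-shapedAt-other M []       s w≢v shapedAt = shapedAt
applyWord-shapedAt-other M (g ∷ gs) s w≢v shapedAt =
  applyWord-shapedAt-other (applyGen M _ g) gs s w≢v (applyGen-shapedAt-other M g s w≢v shapedAt)

applyGen-shaped : (M : SetSystem n) (w : Fin n) (g : FlipGen) → Shaped M → Shaped (applyGen M w g)
applyGen-shaped M w g shaped v with shaped v | w ≟ v
... | s , shapedAt | yes refl = shapeAfter g s , applyGen-shapedAt-self M g s shapedAt
... | s , shapedAt | no w≢v   = s , applyGen-shapedAt-other M g s w≢v shapedAt

applyWord-shaped : (M : SetSystem n) (w : Fin n) (gs : List FlipGen) →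
                   Shaped M → Shaped (applyWord M w gs)
applyWord-shaped M w []       shaped = shaped
applyWord-shaped M w (g ∷ gs) shaped =
  applyWord-shaped (applyGen M w g) w gs (applyGen-shaped M w g shaped)

applySeq-shaped : (M : SetSystem n) (φ : List (VertexFlip n)) → Shaped M → Shaped (applySeq M φ)
applySeq-shaped M []             shaped = shaped
applySeq-shaped M ((w , gs) ∷ φ) shaped =
  applySeq-shaped (applyWord M w gs) φ (applyWord-shaped M w gs shaped)

stronglyDivisible-resp : {M N : SetSystem n} → (∀ Y → M Y ≡ N Y) →
                         StronglyDivisible M → StronglyDivisible N
stronglyDivisible-resp {M = M} {N} M≗N (u , (X₁ , X₂ , X₁∈M , X₂∈M , u∈X₁⊕X₂) , X , X∈M , X⊕u∉M) =
  u , (X₁ , X₂ , ∈-resp X₁∈M , ∈-resp X₂∈M , u∈X₁⊕X₂) , X , ∈-resp X∈M , X⊕u∉N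
  where
  ∈-resp : ∀ {Y} → Y ∈ₛ M → Y ∈ₛ N
  ∈-resp {Y} = trans (sym (M≗N Y))
  X⊕u∉N : (X ⊕ ⁅ u ⁆) ∉ₛ N
  X⊕u∉N X⊕u∈N = X⊕u∉M (trans (M≗N (X ⊕ ⁅ u ⁆)) X⊕u∈N)

applyGen-stronglyDivisible : (M : SetSystem n) (w : Fin n) (g : FlipGen) →
                             StronglyDivisible M → StronglyDivisible (applyGen M w g)
applyGen-stronglyDivisible M w g sd with stronglyDivisible? (applyGen M w g)
... | yes sd′ = sd′
... | no ¬sd′ = ⊥-elim (shaped⇒¬stronglyDivisible
  (applyGen-shaped (applyGen M w g) w g (¬stronglyDivisible⇒shaped ¬sd′))
  (stronglyDivisible-resp (λ Y → sym (applyGen-involutive M w g Y)) sd))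

applyWord-stronglyDivisible : (M : SetSystem n) (w : Fin n) (gs : List FlipGen) →
                              StronglyDivisible M → StronglyDivisible (applyWord M w gs)
applyWord-stronglyDivisible M w []       sd = sd
applyWord-stronglyDivisible M w (g ∷ gs) sd =
  applyWord-stronglyDivisible (applyGen M w g) w gs (applyGen-stronglyDivisible M w g sd)

applySeq-stronglyDivisible : (M : SetSystem n) (φ : List (VertexFlip n)) →
                             StronglyDivisible M → StronglyDivisible (applySeq M φ)
applySeq-stronglyDivisible M []             sd = sd
applySeq-stronglyDivisible M ((w , gs) ∷ φ) sd =
  applySeq-stronglyDivisible (applyWord M w gs) φ (applyWord-stronglyDivisible M w gs sd)

stronglyDivisible⇒atLeastTwo : StronglyDivisible M → AtLeastTwo M
stronglyDivisible⇒atLeastTwo (u , (X₁ , X₂ , X₁∈M , X₂∈M , u∈X₁⊕X₂) , _) =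
  X₁ , X₂ , X₁≢X₂ , X₁∈M , X₂∈M
  where
  X₁≢X₂ : X₁ ≢ X₂
  X₁≢X₂ X₁≡X₂ = lookup-⊕-differ u∈X₁⊕X₂ (cong (λ X → lookup X u) X₁≡X₂)

avoidingWord : Shape → List FlipGen
avoidingWord (uniform false) = []
avoidingWord (uniform true)  = piv ∷ []
avoidingWord symmetric       = loop ∷ []

applyWord-avoidingWord : (M : SetSystem n) (s : Shape) → ShapedAt M w s →
                         Avoids (applyWord M w (avoidingWord s)) w
applyWord-avoidingWord M (uniform false) avoids = avoids
applyWord-avoidingWord M (uniform true)  agree  = applyGen-shapedAt-self M piv (uniform true) agree
applyWord-avoidingWord M symmetric       closed = applyGen-shapedAt-self M loop symmetric closed

applySeq-++ : (M : SetSystem n) (φ ψ : List (VertexFlip n)) →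
              applySeq M (φ ++ ψ) ≡ applySeq (applySeq M φ) ψ
applySeq-++ M []      ψ = refl
applySeq-++ M (f ∷ φ) ψ = applySeq-++ (applyFlip M f) φ ψ

avoidAll : (M : SetSystem n) (vs : List (Fin n)) → Shaped M →
           ∃[ φ ] (∀ {v} → v ∈ˡ vs → Avoids (applySeq M φ) v)
avoidAll M []       shaped = [] , λ ()
avoidAll M (w ∷ vs) shaped with avoidAll M vs shaped
... | φ , avoids-vs with applySeq-shaped M φ shaped w
...   | s , shapedAt-w = φ ∷ʳ (w , avoidingWord s) , avoids
  where
  avoids′ : ∀ {v} → v ∈ˡ w ∷ vs → Avoids (applyWord (applySeq M φ) w (avoidingWord s)) v
  avoids′ (here refl) = applyWord-avoidingWord _ s shapedAt-w
  avoids′ {v} (there v∈vs) with w ≟ v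
  ... | yes refl = applyWord-avoidingWord _ s shapedAt-w
  ... | no w≢v   = applyWord-shapedAt-other _ (avoidingWord s) (uniform false) w≢v (avoids-vs v∈vs)

  avoids : ∀ {v} → v ∈ˡ w ∷ vs → Avoids (applySeq M (φ ∷ʳ (w , avoidingWord s))) v
  avoids {v} v∈ = subst (λ N → Avoids N v) (sym (applySeq-++ M φ _)) (avoids′ v∈)

avoidsAll⇒≡⊥ : (∀ v → Avoids M v) → (X : Subset n) → X ∈ₛ M → X ≡ ⊥
avoidsAll⇒≡⊥ avoids X X∈M =
  Pointwise-≡⇒≡ (ext λ i → trans (avoids i X X∈M) (sym (lookup-replicate i false)))

shaped⇒flippable-¬atLeastTwo : (M : SetSystem n) → Shaped M →
                               ∃[ φ ] ¬ AtLeastTwo (applySeq M φ)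
shaped⇒flippable-¬atLeastTwo {n} M shaped with avoidAll M (allFin n) shaped
... | φ , avoids = φ , λ (Y , Z , Y≢Z , Y∈N , Z∈N) →
  Y≢Z (trans (avoidsAll⇒≡⊥ avoidsAll Y Y∈N) (sym (avoidsAll⇒≡⊥ avoidsAll Z Z∈N)))
  where
  avoidsAll : ∀ v → Avoids (applySeq M φ) v
  avoidsAll v = avoids (∈-allFin v)

stronglyDivisible⇒alwaysAtLeastTwo : (M : SetSystem n) → StronglyDivisible M →
                                     (φ : List (VertexFlip n)) → AtLeastTwo (applySeq M φ)
stronglyDivisible⇒alwaysAtLeastTwo M sd φ =
  stronglyDivisible⇒atLeastTwo (applySeq-stronglyDivisible M φ sd)

alwaysAtLeastTwo⇒stronglyDivisible : (M : SetSystem n) →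
                                     ((φ : List (VertexFlip n)) → AtLeastTwo (applySeq M φ)) →
                                     StronglyDivisible M
alwaysAtLeastTwo⇒stronglyDivisible M alwaysTwo with stronglyDivisible? M
... | yes sd  = sd
... | no  ¬sd with shaped⇒flippable-¬atLeastTwo M (¬stronglyDivisible⇒shaped ¬sd)
...   | φ , ¬two = ⊥-elim (¬two (alwaysTwo φ))

lemma14 : (n : ℕ) (M : SetSystem n) → Proper M →
    (StronglyDivisible M → (φ : List (VertexFlip n)) → AtLeastTwo (applySeq M φ))
    × (((φ : List (VertexFlip n)) → AtLeastTwo (applySeq M φ)) → StronglyDivisible M)
lemma14 n M _ = stronglyDivisible⇒alwaysAtLeastTwo M , alwaysAtLeastTwo⇒stronglyDivisible M
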